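{- Let $r\ge 4$, $m=2^r$, $\zeta=e^{2\pi i/m}$, $\mathbb{K}=\mathbb{Q}(\zeta+\zeta^{ -1})$ and $$\alpha=4+(\zeta+\zeta^{ -1})-2(\zeta^{2}+\zeta^{ -2})-(\zeta^{3}+\zeta^{ -3}).$$ Then $N_{\mathbb{K}|\mathbb{Q}}(\alpha)=8$.
   Context: $N_{\mathbb{K}|\mathbb{Q}}(x)=\prod_{i=1}^{n}\sigma_i(x)$, where $\sigma_1,\dots,\sigma_n$ are the embeddings of $\mathbb{K}$ into $\mathbb{C}$ and $n=[\mathbb{K}:\mathbb{Q}]=2^{r-2}$. -}

module Defs where

open import Data.Nat using (ℕ; zero; suc; _∸_; _^_) renaming (_+_ to _+ℕ_; _*_ to _*ℕ_)
open import Data.Integer using (ℤ; 0ℤ; 1ℤ; +_; _+_; _*_; -_)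
open import Data.Vec using (Vec; []; _∷_; replicate; zipWith; map)
open import Data.List using (List; upTo; foldr) renaming (map to lmap)
open import Data.Product using (_×_; _,_)

-- The cyclotomic ring ℤ[ζ] for ζ a primitive 2N-th root of unity, N a power of 2,
-- realised as ℤ[x]/(x^N + 1).  An element is its coefficient vector
-- (c₀,…,c_{N-1}) w.r.t. the basis 1, ζ, …, ζ^{N-1}.
Cyc : ℕ → Set
Cyc N = Vec ℤ N

0C : ∀ {N} → Cyc N
0C = replicate _ 0ℤ

1C : ∀ {N} → Cyc N
1C {zero}  = []
1C {suc n} = 1ℤ ∷ replicate _ 0ℤ

_⊕_ : ∀ {N} → Cyc N → Cyc N → Cyc N
_⊕_ = zipWith _+_

scale : ∀ {N} → ℤ → Cyc N → Cyc N
scale c = map (c *_)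

const : ∀ {N} → ℤ → Cyc N
const c = scale c 1C

shiftIn : ∀ {n} → ℤ → Vec ℤ n → Vec ℤ n × ℤ
shiftIn a []       = [] , a
shiftIn a (c ∷ cs) with shiftIn c cs
... | v , l = a ∷ v , l

mulζ : ∀ {N} → Cyc N → Cyc N
mulζ []       = []
mulζ (c ∷ cs) with shiftIn c cs
... | w , l = (- l) ∷ w

mulζ^ : ∀ {N} → ℕ → Cyc N → Cyc N
mulζ^ zero    v = v
mulζ^ (suc j) v = mulζ (mulζ^ j v)

ζ^ : ∀ {N} → ℕ → Cyc N
ζ^ j = mulζ^ j 1C

-- ζ^{-j} = ζ^{(2N-1) j}, since ζ^{2N} = 1
ζ^- : ∀ N → ℕ → Cyc N
ζ^- N j = ζ^ (j *ℕ (2 *ℕ N ∸ 1))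

mulAux : ∀ {k N} → Vec ℤ k → Cyc N → Cyc N
mulAux []       b = 0C
mulAux (a ∷ as) b = scale a b ⊕ mulAux as (mulζ b)

_⊗_ : ∀ {N} → Cyc N → Cyc N → Cyc N
a ⊗ b = mulAux a b

prodC : ∀ {N} → List (Cyc N) → Cyc N
prodC = foldr _⊗_ 1C

-- σ_k(α) where α = 4 + (ζ+ζ⁻¹) - 2(ζ²+ζ⁻²) - (ζ³+ζ⁻³) and σ_k : ζ ↦ ζ^k
σα : ∀ N → ℕ → Cyc N
σα N k =
  const (+ 4)
  ⊕ ((ζ^ k ⊕ ζ^- N k)
  ⊕ (scale (- (+ 2)) (ζ^ (2 *ℕ k) ⊕ ζ^- N (2 *ℕ k))
  ⊕ scale (- (+ 1)) (ζ^ (3 *ℕ k) ⊕ ζ^- N (3 *ℕ k))))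

-- odd exponents 1, 3, …, 2^{r-1} - 1 : these index the 2^{r-2} embeddings of
-- 𝕂 = ℚ(ζ+ζ⁻¹) (ζ+ζ⁻¹ ↦ ζ^k + ζ^{-k}), m = 2^r
embeddingExps : ℕ → List ℕ
embeddingExps r = lmap (λ i → suc (2 *ℕ i)) (upTo (2 ^ (r ∸ 2)))

-- N_{𝕂|ℚ}(α) = ∏ σ_k(α), computed in ℤ[ζ_m] with m = 2^r, N = 2^{r-1}
normα : (r : ℕ) → Cyc (2 ^ (r ∸ 1))
normα r = prodC (lmap (σα (2 ^ (r ∸ 1))) (embeddingExps r))

-- With θ = ζ + ζ⁻¹ one has α = (2 + θ)²(2 - θ), and 2 ± θ = (1 ± ζ)(1 ± ζ⁻¹). The embeddings of 𝕂
-- send ζ to ζᵏ for the odd k < 2^(r-1); as k runs through these, ζ⁻ᵏ = -ζ^(2^(r-1) - k) runs through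
-- the -ζᵏ. Hence N(2 + θ) and N(2 - θ) both equal ∏ₖ (1 + ζᵏ)(1 - ζᵏ) = ∏ₖ (1 - ζ^(2k)) = Φ_{2^(r-1)}(1) = 2,
-- and N(α) = 2² · 2 = 8. The computation takes place in ℤ[ζ] = ℤ[x]/(x^(2^(r-1)) + 1) and uses only
-- ζ^(2^(r-1)) = -1.

module Submission where

open import Defs
open import Data.Nat as ℕ using (ℕ; zero; suc; _≤_; _<_; _∸_; s≤s; z≤n)
  renaming (_+_ to _+ℕ_; _*_ to _*ℕ_)
import Data.Nat.Properties as ℕP
open import Data.Nat.Tactic.RingSolver using (solve-∀)
open import Data.Integer using (ℤ; 0ℤ; 1ℤ; -1ℤ; +_; _+_; _*_; -_; +-*-rawRing) renaming (_≟_ to _≟ℤ_)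
import Data.Integer.Properties as ℤP
open import Data.Vec using (Vec; []; _∷_; replicate; map; _∷ʳ_; toList; initLast)
import Data.Vec.Properties as VP
open import Data.Vec.Relation.Binary.Equality.Cast using (cast-is-id)
import Data.List as L
import Data.List.Properties as LP
open import Data.Product using (_,_; proj₁; proj₂)
open import Algebra.Structures using (IsAbelianGroup; IsCommutativeRing)
open import Algebra.Bundles using (AbelianGroup; CommutativeSemiring; CommutativeRing)
open import Algebra.Solver.Ring.AlmostCommutativeRing using (fromCommutativeRing; _-Raw-AlmostCommutative⟶_)
import Algebra.Properties.CommutativeSemiring.Exp as Exp
open import Data.Maybe using () renaming (map to mapMaybe)
open import Relation.Nullary.Decidable.Core using (dec⇒maybe)
import Algebra.Properties.CommutativeSemigroup as CommSemigroupProperties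
open import Relation.Binary.PropositionalEquality
  using (_≡_; refl; sym; trans; cong; cong₂; subst; isEquivalence; module ≡-Reasoning)

-- ℤ[ζ] as a commutative ring

negC : ∀ {N} → Cyc N → Cyc N
negC = map -_

⊕-isAbelianGroup : ∀ N → IsAbelianGroup _≡_ (_⊕_ {N}) 0C negC
⊕-isAbelianGroup N = record
  { isGroup = record
    { isMonoid = record
      { isSemigroup = record
        { isMagma = record { isEquivalence = isEquivalence ; ∙-cong = cong₂ _⊕_ }
        ; assoc = VP.zipWith-assoc ℤP.+-assoc }
      ; identity = VP.zipWith-identityˡ ℤP.+-identityˡ , VP.zipWith-identityʳ ℤP.+-identityʳ }
    ; inverse = VP.zipWith-inverseˡ ℤP.+-inverseˡ , VP.zipWith-inverseʳ ℤP.+-inverseʳ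
    ; ⁻¹-cong = cong negC }
  ; comm = VP.zipWith-comm ℤP.+-comm }

⊕-abelianGroup : ℕ → AbelianGroup _ _
⊕-abelianGroup N = record { isAbelianGroup = ⊕-isAbelianGroup N }

module _ {N : ℕ} where
  open AbelianGroup (⊕-abelianGroup N) public
    using () renaming (assoc to ⊕-assoc; identityˡ to ⊕-identityˡ; identityʳ to ⊕-identityʳ)
  open CommSemigroupProperties (AbelianGroup.commutativeSemigroup (⊕-abelianGroup N)) public
    using () renaming (interchange to ⊕-interchange)

scale-distribˡ-⊕ : ∀ {N} c (a b : Cyc N) → scale c (a ⊕ b) ≡ scale c a ⊕ scale c b
scale-distribˡ-⊕ c [] [] = refl
scale-distribˡ-⊕ c (x ∷ a) (y ∷ b) = cong₂ _∷_ (ℤP.*-distribˡ-+ c x y) (scale-distribˡ-⊕ c a b)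

scale-distribʳ-+ : ∀ {N} c d (a : Cyc N) → scale (c + d) a ≡ scale c a ⊕ scale d a
scale-distribʳ-+ c d [] = refl
scale-distribʳ-+ c d (x ∷ a) = cong₂ _∷_ (ℤP.*-distribʳ-+ x c d) (scale-distribʳ-+ c d a)

scale-scale : ∀ {N} c d (a : Cyc N) → scale c (scale d a) ≡ scale (c * d) a
scale-scale c d a = trans (sym (VP.map-∘ (c *_) (d *_) a)) (VP.map-cong (λ x → sym (ℤP.*-assoc c d x)) a)

scale-comm : ∀ {N} c d (a : Cyc N) → scale c (scale d a) ≡ scale d (scale c a)
scale-comm c d a = trans (scale-scale c d a) (trans (cong (λ e → scale e a) (ℤP.*-comm c d)) (sym (scale-scale d c a)))

scale-identity : ∀ {N} (a : Cyc N) → scale 1ℤ a ≡ a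
scale-identity a = trans (VP.map-cong ℤP.*-identityˡ a) (VP.map-id a)

scale-zeroˡ : ∀ {N} (a : Cyc N) → scale 0ℤ a ≡ 0C
scale-zeroˡ a = trans (VP.map-cong ℤP.*-zeroˡ a) (VP.map-const a 0ℤ)

scale-zeroʳ : ∀ {N} c → scale c (0C {N}) ≡ 0C
scale-zeroʳ {N} c = trans (VP.map-replicate (c *_) 0ℤ N) (cong (replicate N) (ℤP.*-zeroʳ c))

negC≡scale-1 : ∀ {N} (a : Cyc N) → negC a ≡ scale -1ℤ a
negC≡scale-1 a = VP.map-cong (λ x → sym (ℤP.-1*i≡-i x)) a

shiftIn-⊕ : ∀ {n} a b (u v : Vec ℤ n) →
  shiftIn (a + b) (u ⊕ v) ≡ (proj₁ (shiftIn a u) ⊕ proj₁ (shiftIn b v) , proj₂ (shiftIn a u) + proj₂ (shiftIn b v))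
shiftIn-⊕ a b [] [] = refl
shiftIn-⊕ a b (c ∷ u) (d ∷ v) rewrite shiftIn-⊕ c d u v with shiftIn c u | shiftIn d v
... | _ , _ | _ , _ = refl

shiftIn-scale : ∀ {n} k a (u : Vec ℤ n) →
  shiftIn (k * a) (scale k u) ≡ (scale k (proj₁ (shiftIn a u)) , k * proj₂ (shiftIn a u))
shiftIn-scale k a [] = refl
shiftIn-scale k a (c ∷ u) rewrite shiftIn-scale k c u with shiftIn c u
... | _ , _ = refl

mulζ-⊕ : ∀ {N} (a b : Cyc N) → mulζ (a ⊕ b) ≡ mulζ a ⊕ mulζ b
mulζ-⊕ [] [] = refl
mulζ-⊕ (x ∷ a) (y ∷ b) rewrite shiftIn-⊕ x y a b with shiftIn x a | shiftIn y b
... | u , l | v , l′ = cong (_∷ (u ⊕ v)) (ℤP.neg-distrib-+ l l′)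

mulζ-scale : ∀ {N} k (a : Cyc N) → mulζ (scale k a) ≡ scale k (mulζ a)
mulζ-scale k [] = refl
mulζ-scale k (x ∷ a) rewrite shiftIn-scale k x a with shiftIn x a
... | u , l = cong (_∷ scale k u) (ℤP.neg-distribʳ-* k l)

mulζ-0C : ∀ {N} → mulζ (0C {N}) ≡ 0C
mulζ-0C = begin
  mulζ 0C              ≡⟨ cong mulζ (sym (scale-zeroʳ 0ℤ)) ⟩
  mulζ (scale 0ℤ 0C)   ≡⟨ mulζ-scale 0ℤ 0C ⟩
  scale 0ℤ (mulζ 0C)   ≡⟨ scale-zeroˡ (mulζ 0C) ⟩
  0C                   ∎
  where open ≡-Reasoning

mulAux-0C : ∀ {k N} (as : Vec ℤ k) → mulAux as (0C {N}) ≡ 0C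
mulAux-0C [] = refl
mulAux-0C (a ∷ as) = begin
  scale a 0C ⊕ mulAux as (mulζ 0C) ≡⟨ cong₂ _⊕_ (scale-zeroʳ a) (trans (cong (mulAux as) mulζ-0C) (mulAux-0C as)) ⟩
  0C ⊕ 0C                          ≡⟨ ⊕-identityˡ 0C ⟩
  0C                               ∎
  where open ≡-Reasoning

mulAux-⊕ʳ : ∀ {k N} (as : Vec ℤ k) (b c : Cyc N) → mulAux as (b ⊕ c) ≡ mulAux as b ⊕ mulAux as c
mulAux-⊕ʳ [] b c = sym (⊕-identityˡ 0C)
mulAux-⊕ʳ (a ∷ as) b c rewrite scale-distribˡ-⊕ a b c | mulζ-⊕ b c | mulAux-⊕ʳ as (mulζ b) (mulζ c) =
  ⊕-interchange (scale a b) (scale a c) (mulAux as (mulζ b)) (mulAux as (mulζ c))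

mulAux-scaleʳ : ∀ {k N} (as : Vec ℤ k) x (b : Cyc N) → mulAux as (scale x b) ≡ scale x (mulAux as b)
mulAux-scaleʳ [] x b = sym (scale-zeroʳ x)
mulAux-scaleʳ (a ∷ as) x b
  rewrite mulζ-scale x b | mulAux-scaleʳ as x (mulζ b) | scale-distribˡ-⊕ x (scale a b) (mulAux as (mulζ b)) =
  cong (_⊕ scale x (mulAux as (mulζ b))) (scale-comm a x b)

mulAux-⊕ˡ : ∀ {k N} (as bs : Vec ℤ k) (c : Cyc N) → mulAux (as ⊕ bs) c ≡ mulAux as c ⊕ mulAux bs c
mulAux-⊕ˡ [] [] c = sym (⊕-identityˡ 0C)
mulAux-⊕ˡ (x ∷ as) (y ∷ bs) c rewrite scale-distribʳ-+ x y c | mulAux-⊕ˡ as bs (mulζ c) =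
  ⊕-interchange (scale x c) (scale y c) (mulAux as (mulζ c)) (mulAux bs (mulζ c))

mulAux-mulζ : ∀ {k N} (as : Vec ℤ k) (b : Cyc N) → mulAux as (mulζ b) ≡ mulζ (mulAux as b)
mulAux-mulζ [] b = sym mulζ-0C
mulAux-mulζ (a ∷ as) b rewrite mulζ-⊕ (scale a b) (mulAux as (mulζ b)) | mulζ-scale a b | mulAux-mulζ as (mulζ b) = refl

-- Both sides are Σᵢ Σⱼ aᵢ bⱼ ζ^(i+j) c, expanded in opposite orders.
mulAux-comm : ∀ {k l N} (as : Vec ℤ k) (bs : Vec ℤ l) (c : Cyc N) → mulAux as (mulAux bs c) ≡ mulAux bs (mulAux as c)
mulAux-comm [] bs c = sym (mulAux-0C bs)
mulAux-comm (a ∷ as) bs c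
  rewrite mulAux-⊕ʳ bs (scale a c) (mulAux as (mulζ c)) | mulAux-scaleʳ bs a c
        | sym (mulAux-comm as bs (mulζ c)) | mulAux-mulζ bs c = refl

shiftIn-∷ʳ : ∀ {n} c (cs : Vec ℤ n) → toList (proj₁ (shiftIn c cs)) L.∷ʳ proj₂ (shiftIn c cs) ≡ c L.∷ toList cs
shiftIn-∷ʳ c [] = refl
shiftIn-∷ʳ c (d ∷ ds) with shiftIn d ds | shiftIn-∷ʳ d ds
... | _ , _ | split = cong (c L.∷_) split

toList-mulζ : ∀ {N} (v : Cyc N) {zs y} → toList v ≡ zs L.∷ʳ y → toList (mulζ v) ≡ (- y) L.∷ zs
toList-mulζ [] {L.[]} ()
toList-mulζ [] {_ L.∷ _} ()
toList-mulζ (c ∷ cs) e with shiftIn c cs | shiftIn-∷ʳ c cs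
... | u , l | split with LP.∷ʳ-injective (toList u) _ (trans split e)
... | refl , refl = refl

toList-mulζ^ : ∀ {N} (w : Cyc N) xs ys → toList w ≡ xs L.++ ys → toList (mulζ^ (L.length ys) w) ≡ L.map -_ ys L.++ xs
toList-mulζ^ w xs L.[] e = trans e (LP.++-identityʳ xs)
toList-mulζ^ w xs (y L.∷ ys) e = toList-mulζ (mulζ^ (L.length ys) w) (begin
  toList (mulζ^ (L.length ys) w)  ≡⟨ toList-mulζ^ w (xs L.∷ʳ y) ys (trans e (sym (LP.++-assoc xs L.[ y ] ys))) ⟩
  L.map -_ ys L.++ (xs L.∷ʳ y)    ≡⟨ sym (LP.++-assoc (L.map -_ ys) xs L.[ y ]) ⟩
  (L.map -_ ys L.++ xs) L.∷ʳ y    ∎)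
  where open ≡-Reasoning

replicate-+ : ∀ {A : Set} m n (x : A) → L.replicate (m +ℕ n) x ≡ L.replicate m x L.++ L.replicate n x
replicate-+ zero    n x = refl
replicate-+ (suc m) n x = cong (x L.∷_) (replicate-+ m n x)

toList-injective : ∀ {A : Set} {n} (xs ys : Vec A n) → toList xs ≡ toList ys → xs ≡ ys
toList-injective xs ys e = trans (sym (cast-is-id refl xs)) (VP.toList-injective refl xs ys e)

mulζ^-N : ∀ {N} (v : Cyc N) → mulζ^ N v ≡ negC v
mulζ^-N {N} v = toList-injective _ _ (begin
  toList (mulζ^ N v)                        ≡⟨ cong (λ j → toList (mulζ^ j v)) (sym (VP.length-toList v)) ⟩
  toList (mulζ^ (L.length (toList v)) v)    ≡⟨ toList-mulζ^ v L.[] (toList v) refl ⟩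
  L.map -_ (toList v) L.++ L.[]             ≡⟨ LP.++-identityʳ _ ⟩
  L.map -_ (toList v)                       ≡⟨ sym (VP.toList-map -_ v) ⟩
  toList (negC v)                           ∎)
  where open ≡-Reasoning

toList-ζ^ : ∀ {n} j → j ≤ n → toList (ζ^ {suc n} j) ≡ L.replicate j 0ℤ L.++ 1ℤ L.∷ L.replicate (n ∸ j) 0ℤ
toList-ζ^ {n} j j≤n = begin
  toList (ζ^ j)                                                ≡⟨ cong (λ i → toList (mulζ^ i 1C)) (sym (LP.length-replicate j)) ⟩
  toList (mulζ^ (L.length (L.replicate j 0ℤ)) 1C)             ≡⟨ toList-mulζ^ 1C (1ℤ L.∷ L.replicate (n ∸ j) 0ℤ) (L.replicate j 0ℤ) toList-1C ⟩
  L.map -_ (L.replicate j 0ℤ) L.++ 1ℤ L.∷ L.replicate (n ∸ j) 0ℤ ≡⟨ cong (L._++ 1ℤ L.∷ L.replicate (n ∸ j) 0ℤ) (LP.map-replicate -_ j 0ℤ) ⟩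
  L.replicate j 0ℤ L.++ 1ℤ L.∷ L.replicate (n ∸ j) 0ℤ        ∎
  where
  open ≡-Reasoning
  toList-1C : toList (1C {suc n}) ≡ (1ℤ L.∷ L.replicate (n ∸ j) 0ℤ) L.++ L.replicate j 0ℤ
  toList-1C = cong (1ℤ L.∷_) (begin
    toList (replicate n 0ℤ)                         ≡⟨ VP.toList-replicate n 0ℤ ⟩
    L.replicate n 0ℤ                                ≡⟨ cong (λ m → L.replicate m 0ℤ) (sym (ℕP.m∸n+n≡m j≤n)) ⟩
    L.replicate (n ∸ j +ℕ j) 0ℤ                     ≡⟨ replicate-+ (n ∸ j) j 0ℤ ⟩
    L.replicate (n ∸ j) 0ℤ L.++ L.replicate j 0ℤ   ∎)

toList-scale-ζ^ : ∀ {n k} x → k ≤ n → toList (scale x (ζ^ {suc n} k)) ≡ L.replicate k 0ℤ L.++ x L.∷ L.replicate (n ∸ k) 0ℤ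
toList-scale-ζ^ {n} {k} x k≤n = begin
  toList (scale x (ζ^ k))                                                  ≡⟨ VP.toList-map (x *_) (ζ^ k) ⟩
  L.map (x *_) (toList (ζ^ k))                                             ≡⟨ cong (L.map (x *_)) (toList-ζ^ k k≤n) ⟩
  L.map (x *_) (L.replicate k 0ℤ L.++ 1ℤ L.∷ L.replicate (n ∸ k) 0ℤ)      ≡⟨ LP.map-++ (x *_) (L.replicate k 0ℤ) _ ⟩
  L.map (x *_) (L.replicate k 0ℤ) L.++ (x * 1ℤ) L.∷ L.map (x *_) (L.replicate (n ∸ k) 0ℤ)
    ≡⟨ cong₂ (λ u v → u L.++ v) (x*0s k) (cong₂ L._∷_ (ℤP.*-identityʳ x) (x*0s (n ∸ k))) ⟩
  L.replicate k 0ℤ L.++ x L.∷ L.replicate (n ∸ k) 0ℤ                       ∎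
  where
  open ≡-Reasoning
  x*0s : ∀ m → L.map (x *_) (L.replicate m 0ℤ) ≡ L.replicate m 0ℤ
  x*0s m = trans (LP.map-replicate (x *_) m 0ℤ) (cong (L.replicate m) (ℤP.*-zeroʳ x))

mulζ^-mulζ : ∀ {N} j (w : Cyc N) → mulζ^ j (mulζ w) ≡ mulζ (mulζ^ j w)
mulζ^-mulζ zero    w = refl
mulζ^-mulζ (suc j) w = cong mulζ (mulζ^-mulζ j w)

mulAux-∷ʳ : ∀ {k N} (as : Vec ℤ k) x (b : Cyc N) → mulAux (as ∷ʳ x) b ≡ mulAux as b ⊕ scale x (mulζ^ k b)
mulAux-∷ʳ [] x b = trans (⊕-identityʳ (scale x b)) (sym (⊕-identityˡ (scale x b)))
mulAux-∷ʳ {suc k} (a ∷ as) x b rewrite mulAux-∷ʳ as x (mulζ b) | mulζ^-mulζ k b =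
  sym (⊕-assoc (scale a b) (mulAux as (mulζ b)) (scale x (mulζ (mulζ^ k b))))

toList-⊕ : ∀ {N} (u v : Cyc N) → toList (u ⊕ v) ≡ L.zipWith _+_ (toList u) (toList v)
toList-⊕ []      []      = refl
toList-⊕ (x ∷ u) (y ∷ v) = cong (x + y L.∷_) (toList-⊕ u v)

zipWith-+-pad : ∀ xs y m →
  L.zipWith _+_ (xs L.++ L.replicate (suc m) 0ℤ) (L.replicate (L.length xs) 0ℤ L.++ y L.∷ L.replicate m 0ℤ)
    ≡ xs L.++ y L.∷ L.replicate m 0ℤ
zipWith-+-pad L.[]         y m = cong₂ L._∷_ (ℤP.+-identityˡ y) (LP.zipWith-replicate m _+_ 0ℤ 0ℤ)
zipWith-+-pad (x L.∷ xs) y m = cong₂ L._∷_ (ℤP.+-identityʳ x) (zipWith-+-pad xs y m)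

toList-mulAux-1C : ∀ {n k} (as : Vec ℤ k) → k ≤ suc n → toList (mulAux as (1C {suc n})) ≡ toList as L.++ L.replicate (suc n ∸ k) 0ℤ
toList-mulAux-1C {n} [] _ = VP.toList-replicate (suc n) 0ℤ
toList-mulAux-1C {n} {suc k} as (s≤s k≤n) with initLast as
... | as′ , x , refl = begin
  toList (mulAux (as′ ∷ʳ x) 1C)
    ≡⟨ cong toList (mulAux-∷ʳ as′ x 1C) ⟩
  toList (mulAux as′ 1C ⊕ scale x (ζ^ k))
    ≡⟨ toList-⊕ _ _ ⟩
  L.zipWith _+_ (toList (mulAux as′ 1C)) (toList (scale x (ζ^ k)))
    ≡⟨ cong₂ (L.zipWith _+_) (toList-mulAux-1C as′ (ℕP.m≤n⇒m≤1+n k≤n)) (toList-scale-ζ^ x k≤n) ⟩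
  L.zipWith _+_ (toList as′ L.++ L.replicate (suc n ∸ k) 0ℤ) (L.replicate k 0ℤ L.++ x L.∷ L.replicate (n ∸ k) 0ℤ)
    ≡⟨ cong₂ (λ i j → L.zipWith _+_ (toList as′ L.++ L.replicate i 0ℤ) (L.replicate j 0ℤ L.++ x L.∷ L.replicate (n ∸ k) 0ℤ))
             (ℕP.+-∸-assoc 1 k≤n) (sym (VP.length-toList as′)) ⟩
  L.zipWith _+_ (toList as′ L.++ L.replicate (suc (n ∸ k)) 0ℤ)
                (L.replicate (L.length (toList as′)) 0ℤ L.++ x L.∷ L.replicate (n ∸ k) 0ℤ)
    ≡⟨ zipWith-+-pad (toList as′) x (n ∸ k) ⟩
  toList as′ L.++ x L.∷ L.replicate (n ∸ k) 0ℤ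
    ≡⟨ sym (LP.++-assoc (toList as′) L.[ x ] _) ⟩
  (toList as′ L.∷ʳ x) L.++ L.replicate (n ∸ k) 0ℤ
    ≡⟨ cong (L._++ L.replicate (n ∸ k) 0ℤ) (sym (VP.toList-∷ʳ x as′)) ⟩
  toList (as′ ∷ʳ x) L.++ L.replicate (n ∸ k) 0ℤ
    ∎
  where open ≡-Reasoning

⊗-identityʳ : ∀ {N} (a : Cyc N) → a ⊗ 1C ≡ a
⊗-identityʳ []            = refl
⊗-identityʳ {suc n} a = toList-injective _ _ (begin
  toList (mulAux a 1C)                         ≡⟨ toList-mulAux-1C a ℕP.≤-refl ⟩
  toList a L.++ L.replicate (n ∸ n) 0ℤ         ≡⟨ cong (λ m → toList a L.++ L.replicate m 0ℤ) (ℕP.n∸n≡0 n) ⟩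
  toList a L.++ L.[]                           ≡⟨ LP.++-identityʳ (toList a) ⟩
  toList a                                     ∎)
  where open ≡-Reasoning

⊗-comm : ∀ {N} (a b : Cyc N) → a ⊗ b ≡ b ⊗ a
⊗-comm a b = begin
  mulAux a b              ≡⟨ cong (mulAux a) (sym (⊗-identityʳ b)) ⟩
  mulAux a (mulAux b 1C)  ≡⟨ mulAux-comm a b 1C ⟩
  mulAux b (mulAux a 1C)  ≡⟨ cong (mulAux b) (⊗-identityʳ a) ⟩
  mulAux b a              ∎
  where open ≡-Reasoning

⊗-identityˡ : ∀ {N} (a : Cyc N) → 1C ⊗ a ≡ a
⊗-identityˡ a = trans (⊗-comm 1C a) (⊗-identityʳ a)

⊗-assoc : ∀ {N} (a b c : Cyc N) → (a ⊗ b) ⊗ c ≡ a ⊗ (b ⊗ c)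
⊗-assoc a b c = begin
  (a ⊗ b) ⊗ c   ≡⟨ ⊗-comm (a ⊗ b) c ⟩
  c ⊗ (a ⊗ b)   ≡⟨ mulAux-comm c a b ⟩
  a ⊗ (c ⊗ b)   ≡⟨ cong (a ⊗_) (⊗-comm c b) ⟩
  a ⊗ (b ⊗ c)   ∎
  where open ≡-Reasoning

Cyc-isCommutativeRing : ∀ N → IsCommutativeRing _≡_ (_⊕_ {N}) _⊗_ negC 0C 1C
Cyc-isCommutativeRing N = record
  { isRing = record
    { +-isAbelianGroup = ⊕-isAbelianGroup N
    ; *-cong = cong₂ _⊗_
    ; *-assoc = ⊗-assoc
    ; *-identity = ⊗-identityˡ , ⊗-identityʳ
    ; distrib = mulAux-⊕ʳ , λ a b c → mulAux-⊕ˡ b c a }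
  ; *-comm = ⊗-comm }

Cyc-commutativeRing : ℕ → CommutativeRing _ _
Cyc-commutativeRing N = record { isCommutativeRing = Cyc-isCommutativeRing N }

module FiniteProducts {c ℓ} (S : CommutativeSemiring c ℓ) where

  open CommutativeSemiring S
    using (Carrier; _≈_; 1#; setoid; *-cong; *-congˡ; *-congʳ; *-assoc; *-comm; *-identityˡ; *-identityʳ; *-commutativeSemigroup)
    renaming (_*_ to _·_; refl to ≈-refl; sym to ≈-sym; trans to ≈-trans)
  open Exp S using (_^_; ^-assocʳ; ^-distrib-*)
  open CommSemigroupProperties *-commutativeSemigroup using () renaming (interchange to *-interchange)
  open import Relation.Binary.Reasoning.Setoid setoid

  ^-comm : ∀ x j k → (x ^ j) ^ k ≈ (x ^ k) ^ j
  ^-comm x j k = begin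
    (x ^ j) ^ k     ≈⟨ ^-assocʳ x j k ⟩
    x ^ (j *ℕ k)    ≡⟨ cong (x ^_) (ℕP.*-comm j k) ⟩
    x ^ (k *ℕ j)    ≈⟨ ^-assocʳ x k j ⟨
    (x ^ k) ^ j     ∎

  1#^ : ∀ k → 1# ^ k ≈ 1#
  1#^ zero    = ≈-refl
  1#^ (suc k) = ≈-trans (*-congˡ (1#^ k)) (*-identityˡ 1#)

  ∏ : ℕ → (ℕ → Carrier) → Carrier
  ∏ zero    f = 1#
  ∏ (suc n) f = f 0 · ∏ n (λ i → f (suc i))

  ∏-cong : ∀ n {f g : ℕ → Carrier} → (∀ i → i < n → f i ≈ g i) → ∏ n f ≈ ∏ n g
  ∏-cong zero    f≈g = ≈-refl
  ∏-cong (suc n) f≈g = *-cong (f≈g 0 (s≤s z≤n)) (∏-cong n (λ i i<n → f≈g (suc i) (s≤s i<n)))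

  ∏-* : ∀ n (f g : ℕ → Carrier) → ∏ n (λ i → f i · g i) ≈ ∏ n f · ∏ n g
  ∏-* zero    f g = ≈-sym (*-identityˡ 1#)
  ∏-* (suc n) f g = ≈-trans (*-congˡ (∏-* n (λ i → f (suc i)) (λ i → g (suc i)))) (*-interchange (f 0) (g 0) _ _)

  ∏-^ : ∀ n (f : ℕ → Carrier) k → ∏ n (λ i → f i ^ k) ≈ ∏ n f ^ k
  ∏-^ zero    f k = ≈-sym (1#^ k)
  ∏-^ (suc n) f k = ≈-trans (*-congˡ (∏-^ n (λ i → f (suc i)) k)) (≈-sym (^-distrib-* (f 0) _ k))

  ∏-+ : ∀ m n (f : ℕ → Carrier) → ∏ (m +ℕ n) f ≈ ∏ m f · ∏ n (λ i → f (m +ℕ i))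
  ∏-+ zero    n f = ≈-sym (*-identityˡ (∏ n f))
  ∏-+ (suc m) n f = ≈-trans (*-congˡ (∏-+ m n (λ i → f (suc i)))) (≈-sym (*-assoc (f 0) _ _))

  ∏-last : ∀ n (f : ℕ → Carrier) → ∏ (suc n) f ≈ ∏ n f · f n
  ∏-last zero    f = ≈-trans (*-identityʳ (f 0)) (≈-sym (*-identityˡ (f 0)))
  ∏-last (suc n) f = ≈-trans (*-congˡ (∏-last n (λ i → f (suc i)))) (≈-sym (*-assoc (f 0) _ _))

  ∏-reverse : ∀ n (f : ℕ → Carrier) → ∏ n f ≈ ∏ n (λ i → f (n ∸ suc i))
  ∏-reverse zero    f = ≈-refl
  ∏-reverse (suc n) f = begin
    ∏ (suc n) f                        ≈⟨ ∏-last n f ⟩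
    ∏ n f · f n                        ≈⟨ *-congʳ (∏-reverse n f) ⟩
    ∏ n (λ i → f (n ∸ suc i)) · f n    ≈⟨ *-comm _ (f n) ⟩
    f n · ∏ n (λ i → f (n ∸ suc i))    ∎

-- The norm of α

odd : ℕ → ℕ
odd i = suc (2 *ℕ i)

odd-+ : ∀ m i → suc (2 *ℕ (m +ℕ i)) ≡ 2 *ℕ m +ℕ suc (2 *ℕ i)
odd-+ = solve-∀

odd-reflect : ∀ {n i} → i < n → odd (n ∸ suc i) +ℕ odd i ≡ 2 *ℕ n
odd-reflect {n} {i} i<n = trans (odd-+-odd (n ∸ suc i) i) (cong (2 *ℕ_) (ℕP.m∸n+n≡m i<n))
  where
  odd-+-odd : ∀ d i → suc (2 *ℕ d) +ℕ suc (2 *ℕ i) ≡ 2 *ℕ (d +ℕ suc i)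
  odd-+-odd = solve-∀

module CycRing (N : ℕ) where

  private
    C = Cyc N
    R = Cyc-commutativeRing N

  open CommutativeRing R using (*-identityʳ; commutativeSemiring)
  open Exp commutativeSemiring using (_^_; ^-homo-*; ^-assocʳ)
  open FiniteProducts commutativeSemiring public using (^-comm; 1#^; ∏; ∏-cong; ∏-*; ∏-^; ∏-+; ∏-reverse)

  const-⊗ : ∀ c (x : C) → const c ⊗ x ≡ scale c x
  const-⊗ c x = begin
    const c ⊗ x          ≡⟨ ⊗-comm (const c) x ⟩
    mulAux x (scale c 1C) ≡⟨ mulAux-scaleʳ x c 1C ⟩
    scale c (x ⊗ 1C)     ≡⟨ cong (scale c) (⊗-identityʳ x) ⟩
    scale c x            ∎
    where open ≡-Reasoning

  const-homomorphism : +-*-rawRing -Raw-AlmostCommutative⟶ fromCommutativeRing R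
  const-homomorphism = record
    { ⟦_⟧    = const
    ; +-homo = λ c d → scale-distribʳ-+ c d 1C
    ; *-homo = λ c d → trans (sym (scale-scale c d 1C)) (sym (const-⊗ c (const d)))
    ; -‿homo = λ c → begin
        scale (- c) 1C          ≡⟨ cong (λ e → scale e 1C) (sym (ℤP.-1*i≡-i c)) ⟩
        scale (-1ℤ * c) 1C      ≡⟨ sym (scale-scale -1ℤ c 1C) ⟩
        scale -1ℤ (const c)     ≡⟨ sym (negC≡scale-1 (const c)) ⟩
        negC (const c)          ∎
    ; 0-homo = scale-zeroˡ 1C
    ; 1-homo = scale-identity 1C }
    where open ≡-Reasoning

  open import Algebra.Solver.Ring +-*-rawRing (fromCommutativeRing R) const-homomorphism
    (λ c d → mapMaybe (cong const) (dec⇒maybe (c ≟ℤ d)))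

  𝟙 𝟚 : C
  𝟙 = const 1ℤ
  𝟚 = const (+ 2)

  -- The paper's α as a function of y = σ(ζ) and v = σ(ζ⁻¹).
  α : C → C → C
  α y v = const (+ 4) ⊕ ((y ⊕ v) ⊕ (scale (- (+ 2)) ((y ^ 2) ⊕ (v ^ 2)) ⊕ scale (- (+ 1)) ((y ^ 3) ⊕ (v ^ 3))))

  -- The two sides differ by (y v - 1) K, with K below.
  α-factorisation : ∀ {y v} → y ⊗ v ≡ 𝟙 →
    α y v ≡ (((𝟙 ⊕ y) ⊗ (𝟙 ⊕ v)) ^ 2) ⊗ ((𝟙 ⊕ negC y) ⊗ (𝟙 ⊕ negC v))
  α-factorisation {y} {v} yv≡1 = begin
    α y v
      ≡⟨ cong₂ (λ a b → const (+ 4) ⊕ ((y ⊕ v) ⊕ (a ⊕ b)))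
               (sym (const-⊗ (- (+ 2)) ((y ^ 2) ⊕ (v ^ 2)))) (sym (const-⊗ (- (+ 1)) ((y ^ 3) ⊕ (v ^ 3)))) ⟩
    const (+ 4) ⊕ ((y ⊕ v) ⊕ ((const (- (+ 2)) ⊗ ((y ^ 2) ⊕ (v ^ 2))) ⊕ (const (- (+ 1)) ⊗ ((y ^ 3) ⊕ (v ^ 3)))))
      ≡⟨ solve 2 (λ y v →
           con (+ 4) :+ ((y :+ v) :+ (con (- (+ 2)) :* (y :^ 2 :+ v :^ 2) :+ con (- (+ 1)) :* (y :^ 3 :+ v :^ 3)))
           := ((con 1ℤ :+ y) :* (con 1ℤ :+ v)) :^ 2 :* ((con 1ℤ :- y) :* (con 1ℤ :- v))
              :+ (y :* v :- con 1ℤ)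
                 :* ((y :+ v) :* (y :+ v) :- y :* v :* (y :+ v) :- (con 1ℤ :+ y :* v) :* (con (+ 3) :+ y :* v)))
           refl y v ⟩
    RHS ⊕ (((y ⊗ v) ⊕ negC 𝟙) ⊗ K)
      ≡⟨ cong (λ u → RHS ⊕ ((u ⊕ negC 𝟙) ⊗ K)) yv≡1 ⟩
    RHS ⊕ ((𝟙 ⊕ negC 𝟙) ⊗ K)
      ≡⟨ solve 2 (λ r k → r :+ (con 1ℤ :- con 1ℤ) :* k := r) refl RHS K ⟩
    RHS ∎
    where
    open ≡-Reasoning
    RHS = (((𝟙 ⊕ y) ⊗ (𝟙 ⊕ v)) ^ 2) ⊗ ((𝟙 ⊕ negC y) ⊗ (𝟙 ⊕ negC v))
    K = (((y ⊕ v) ⊗ (y ⊕ v)) ⊕ negC ((y ⊗ v) ⊗ (y ⊕ v))) ⊕ negC ((𝟙 ⊕ (y ⊗ v)) ⊗ (const (+ 3) ⊕ (y ⊗ v)))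

  -- Φ(1) = 2 for Φ = x^(2^t) + 1 = ∏ᵢ (x - z^(2i+1)). Pairing the factors i and 2^(t-1) + i,
  -- whose product is 1 - (z²)^(2i+1), halves t.
  ∏-1-odd-powers : ∀ t z → z ^ (2 ℕ.^ t) ≡ negC 𝟙 → ∏ (2 ℕ.^ t) (λ i → 𝟙 ⊕ negC (z ^ odd i)) ≡ 𝟚
  ∏-1-odd-powers zero z z≡-1 = begin
    (𝟙 ⊕ negC (z ^ 1)) ⊗ 1C  ≡⟨ *-identityʳ _ ⟩
    𝟙 ⊕ negC (z ^ 1)         ≡⟨ cong (λ u → 𝟙 ⊕ negC u) z≡-1 ⟩
    𝟙 ⊕ negC (negC 𝟙)        ≡⟨ solve 0 (con 1ℤ :- (:- con 1ℤ) := con (+ 2)) refl ⟩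
    𝟚                        ∎
    where open ≡-Reasoning
  ∏-1-odd-powers (suc t) z z^2m≡-1 = begin
    ∏ (m +ℕ (m +ℕ 0)) f                      ≡⟨ cong (λ k → ∏ (m +ℕ k) f) (ℕP.+-identityʳ m) ⟩
    ∏ (m +ℕ m) f                             ≡⟨ ∏-+ m m f ⟩
    ∏ m f ⊗ ∏ m (λ i → f (m +ℕ i))           ≡⟨ sym (∏-* m f (λ i → f (m +ℕ i))) ⟩
    ∏ m (λ i → f i ⊗ f (m +ℕ i))             ≡⟨ ∏-cong m (λ i _ → f-pair i) ⟩
    ∏ m (λ i → 𝟙 ⊕ negC ((z ^ 2) ^ odd i))   ≡⟨ ∏-1-odd-powers t (z ^ 2) (trans (^-assocʳ z 2 m) z^2m≡-1) ⟩
    𝟚                                        ∎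
    where
    open ≡-Reasoning
    m = 2 ℕ.^ t
    f : ℕ → C
    f i = 𝟙 ⊕ negC (z ^ odd i)
    f-pair : ∀ i → f i ⊗ f (m +ℕ i) ≡ 𝟙 ⊕ negC ((z ^ 2) ^ odd i)
    f-pair i = begin
      f i ⊗ (𝟙 ⊕ negC (z ^ odd (m +ℕ i)))
        ≡⟨ cong (λ u → f i ⊗ (𝟙 ⊕ negC u)) (trans (cong (z ^_) (odd-+ m i)) (^-homo-* z (2 *ℕ m) (odd i))) ⟩
      f i ⊗ (𝟙 ⊕ negC ((z ^ (2 *ℕ m)) ⊗ (z ^ odd i)))
        ≡⟨ cong (λ u → f i ⊗ (𝟙 ⊕ negC (u ⊗ (z ^ odd i)))) z^2m≡-1 ⟩
      f i ⊗ (𝟙 ⊕ negC (negC 𝟙 ⊗ (z ^ odd i)))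
        ≡⟨ solve 1 (λ y → (con 1ℤ :- y) :* (con 1ℤ :- (:- con 1ℤ) :* y) := con 1ℤ :- y :^ 2) refl (z ^ odd i) ⟩
      𝟙 ⊕ negC ((z ^ odd i) ^ 2)
        ≡⟨ cong (λ u → 𝟙 ⊕ negC u) (^-comm z (odd i) 2) ⟩
      𝟙 ⊕ negC ((z ^ 2) ^ odd i)
        ∎

  module Embeddings (t : ℕ) (N≡2n : N ≡ 2 *ℕ 2 ℕ.^ t) (w : C) (w^N≡-1 : w ^ N ≡ negC 𝟙) where

    private
      n = 2 ℕ.^ t
      E = 2 *ℕ N ∸ 1

    -- y i and v i are the images of ζ and ζ⁻¹ = ζ^E under the embedding ζ ↦ w^(2i+1).
    y v : ℕ → C
    y i = w ^ odd i
    v i = w ^ (odd i *ℕ E)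

    w^2N≡1 : w ^ (2 *ℕ N) ≡ 1C
    w^2N≡1 = begin
      w ^ (2 *ℕ N)     ≡⟨ cong (w ^_) (ℕP.*-comm 2 N) ⟩
      w ^ (N *ℕ 2)     ≡⟨ sym (^-assocʳ w N 2) ⟩
      (w ^ N) ^ 2      ≡⟨ cong (_^ 2) w^N≡-1 ⟩
      (negC 𝟙) ^ 2     ≡⟨ solve 0 ((:- con 1ℤ) :^ 2 := con 1ℤ) refl ⟩
      𝟙                ≡⟨ scale-identity 1C ⟩
      1C               ∎
      where open ≡-Reasoning

    y⊗v≡1 : ∀ i → y i ⊗ v i ≡ 𝟙
    y⊗v≡1 i = begin
      y i ⊗ v i                ≡⟨ sym (^-homo-* w (odd i) (odd i *ℕ E)) ⟩
      w ^ (odd i +ℕ odd i *ℕ E) ≡⟨ cong (w ^_) exponent ⟩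
      w ^ (2 *ℕ N *ℕ odd i)    ≡⟨ sym (^-assocʳ w (2 *ℕ N) (odd i)) ⟩
      (w ^ (2 *ℕ N)) ^ odd i   ≡⟨ cong (_^ odd i) w^2N≡1 ⟩
      1C ^ odd i               ≡⟨ 1#^ (odd i) ⟩
      1C                       ≡⟨ sym (scale-identity 1C) ⟩
      𝟙                        ∎
      where
      open ≡-Reasoning
      1≤N : 1 ≤ N
      1≤N = subst (1 ≤_) (sym N≡2n) (ℕP.≤-trans (ℕP.m^n>0 2 t) (ℕP.m≤n*m n 2))
      1≤2N : 1 ≤ 2 *ℕ N
      1≤2N = ℕP.≤-trans 1≤N (ℕP.m≤n*m N 2)
      exponent : odd i +ℕ odd i *ℕ E ≡ 2 *ℕ N *ℕ odd i
      exponent = trans (sym (ℕP.*-suc (odd i) E)) (trans (cong (odd i *ℕ_) (ℕP.m+[n∸m]≡n 1≤2N)) (ℕP.*-comm (odd i) _))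

    y-reflect : ∀ i → i < n → y (n ∸ suc i) ≡ negC (v i)
    y-reflect i i<n = begin
      x                       ≡⟨ solve 1 (λ x → x := x :* con 1ℤ) refl x ⟩
      x ⊗ 𝟙                   ≡⟨ cong (x ⊗_) (sym (y⊗v≡1 i)) ⟩
      x ⊗ (y i ⊗ v i)         ≡⟨ sym (⊗-assoc x (y i) (v i)) ⟩
      (x ⊗ y i) ⊗ v i         ≡⟨ cong (_⊗ v i) x⊗y≡-1 ⟩
      negC 𝟙 ⊗ v i            ≡⟨ solve 1 (λ u → (:- con 1ℤ) :* u := :- u) refl (v i) ⟩
      negC (v i)              ∎
      where
      open ≡-Reasoning
      x = y (n ∸ suc i)
      x⊗y≡-1 : x ⊗ y i ≡ negC 𝟙
      x⊗y≡-1 = trans (sym (^-homo-* w (odd (n ∸ suc i)) (odd i)))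
                     (trans (cong (w ^_) (trans (odd-reflect i<n) (sym N≡2n))) w^N≡-1)

    ∏-1+v : ∏ n (λ i → 𝟙 ⊕ v i) ≡ ∏ n (λ i → 𝟙 ⊕ negC (y i))
    ∏-1+v = sym (trans (∏-reverse n _) (∏-cong n (λ i i<n →
      trans (cong (λ u → 𝟙 ⊕ negC u) (y-reflect i i<n)) (solve 1 (λ u → con 1ℤ :- (:- u) := con 1ℤ :+ u) refl (v i)))))

    ∏-1-v : ∏ n (λ i → 𝟙 ⊕ negC (v i)) ≡ ∏ n (λ i → 𝟙 ⊕ y i)
    ∏-1-v = sym (trans (∏-reverse n _) (∏-cong n (λ i i<n → cong (𝟙 ⊕_) (y-reflect i i<n))))

    ∏-1+y⊗∏-1-y : ∏ n (λ i → 𝟙 ⊕ y i) ⊗ ∏ n (λ i → 𝟙 ⊕ negC (y i)) ≡ 𝟚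
    ∏-1+y⊗∏-1-y = begin
      ∏ n (λ i → 𝟙 ⊕ y i) ⊗ ∏ n (λ i → 𝟙 ⊕ negC (y i))   ≡⟨ sym (∏-* n _ _) ⟩
      ∏ n (λ i → (𝟙 ⊕ y i) ⊗ (𝟙 ⊕ negC (y i)))           ≡⟨ ∏-cong n (λ i _ → difference-of-squares i) ⟩
      ∏ n (λ i → 𝟙 ⊕ negC ((w ^ 2) ^ odd i))            ≡⟨ ∏-1-odd-powers t (w ^ 2) w²^n≡-1 ⟩
      𝟚                                                  ∎
      where
      open ≡-Reasoning
      w²^n≡-1 : (w ^ 2) ^ n ≡ negC 𝟙
      w²^n≡-1 = trans (^-assocʳ w 2 n) (trans (cong (w ^_) (sym N≡2n)) w^N≡-1)
      difference-of-squares : ∀ i → (𝟙 ⊕ y i) ⊗ (𝟙 ⊕ negC (y i)) ≡ 𝟙 ⊕ negC ((w ^ 2) ^ odd i)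
      difference-of-squares i =
        trans (solve 1 (λ u → (con 1ℤ :+ u) :* (con 1ℤ :- u) := con 1ℤ :- u :^ 2) refl (y i))
              (cong (λ u → 𝟙 ⊕ negC u) (^-comm w (odd i) 2))

    ∏-α≡8 : ∏ n (λ i → α (y i) (v i)) ≡ const (+ 8)
    ∏-α≡8 = begin
      ∏ n (λ i → α (y i) (v i))                     ≡⟨ ∏-cong n (λ i _ → α-factorisation (y⊗v≡1 i)) ⟩
      ∏ n (λ i → (A i ^ 2) ⊗ B i)                   ≡⟨ ∏-* n _ B ⟩
      ∏ n (λ i → A i ^ 2) ⊗ ∏ n B                   ≡⟨ cong (_⊗ ∏ n B) (∏-^ n A 2) ⟩
      (∏ n A ^ 2) ⊗ ∏ n B                           ≡⟨ cong₂ (λ a b → (a ^ 2) ⊗ b) ∏A≡2 ∏B≡2 ⟩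
      (𝟚 ^ 2) ⊗ 𝟚                                   ≡⟨ solve 0 (con (+ 2) :^ 2 :* con (+ 2) := con (+ 8)) refl ⟩
      const (+ 8)                                   ∎
      where
      open ≡-Reasoning
      A B : ℕ → C
      A i = (𝟙 ⊕ y i) ⊗ (𝟙 ⊕ v i)
      B i = (𝟙 ⊕ negC (y i)) ⊗ (𝟙 ⊕ negC (v i))
      ∏A≡2 : ∏ n A ≡ 𝟚
      ∏A≡2 = trans (∏-* n _ _) (trans (cong (∏ n (λ i → 𝟙 ⊕ y i) ⊗_) ∏-1+v) ∏-1+y⊗∏-1-y)
      ∏B≡2 : ∏ n B ≡ 𝟚
      ∏B≡2 = trans (∏-* n _ _) (trans (cong (∏ n (λ i → 𝟙 ⊕ negC (y i)) ⊗_) ∏-1-v)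
                                (trans (⊗-comm (∏ n (λ i → 𝟙 ⊕ negC (y i))) _) ∏-1+y⊗∏-1-y))

  ζ : C
  ζ = mulζ 1C

  ζ⊗ : ∀ u → ζ ⊗ u ≡ mulζ u
  ζ⊗ u = trans (⊗-comm ζ u) (trans (mulAux-mulζ u 1C) (cong mulζ (⊗-identityʳ u)))

  ζ^≡ζ^ : ∀ j → ζ^ j ≡ ζ ^ j
  ζ^≡ζ^ zero    = refl
  ζ^≡ζ^ (suc j) = trans (cong mulζ (ζ^≡ζ^ j)) (sym (ζ⊗ (ζ ^ j)))

  ζ^N≡-1 : ζ ^ N ≡ negC 𝟙
  ζ^N≡-1 = trans (sym (ζ^≡ζ^ N)) (trans (mulζ^-N 1C) (cong negC (sym (scale-identity 1C))))

  ζ^-* : ∀ c j → ζ^ (c *ℕ j) ≡ (ζ ^ j) ^ c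
  ζ^-* c j = trans (ζ^≡ζ^ (c *ℕ j)) (trans (cong (ζ ^_) (ℕP.*-comm c j)) (sym (^-assocʳ ζ j c)))

  ζ^--* : ∀ c j → ζ^- N (c *ℕ j) ≡ (ζ ^ (j *ℕ (2 *ℕ N ∸ 1))) ^ c
  ζ^--* c j = trans (cong ζ^ (ℕP.*-assoc c j _)) (ζ^-* c _)

  σα≡α : ∀ k → σα N k ≡ α (ζ ^ k) (ζ ^ (k *ℕ (2 *ℕ N ∸ 1)))
  σα≡α k = cong₂ (λ p q → const (+ 4) ⊕ (p ⊕ q))
    (cong₂ _⊕_ (ζ^≡ζ^ k) (ζ^≡ζ^ (k *ℕ (2 *ℕ N ∸ 1))))
    (cong₂ _⊕_ (cong (scale (- (+ 2))) (cong₂ _⊕_ (ζ^-* 2 k) (ζ^--* 2 k)))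
               (cong (scale (- (+ 1))) (cong₂ _⊕_ (ζ^-* 3 k) (ζ^--* 3 k))))

  prodC-map-applyUpTo : ∀ (g : ℕ → C) (f h : ℕ → ℕ) n → prodC (L.map g (L.map f (L.applyUpTo h n))) ≡ ∏ n (λ i → g (f (h i)))
  prodC-map-applyUpTo g f h zero    = refl
  prodC-map-applyUpTo g f h (suc n) = cong (g (f (h 0)) ⊗_) (prodC-map-applyUpTo g f (λ i → h (suc i)) n)

normα-2+ : ∀ s → normα (2 +ℕ s) ≡ const (+ 8)
normα-2+ s = begin
  normα (2 +ℕ s)                                    ≡⟨ prodC-map-applyUpTo (σα N) odd (λ i → i) n ⟩
  ∏ n (λ i → σα N (odd i))                          ≡⟨ ∏-cong n (λ i _ → σα≡α (odd i)) ⟩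
  ∏ n (λ i → α (y i) (v i))                         ≡⟨ ∏-α≡8 ⟩
  const (+ 8)                                       ∎
  where
  open ≡-Reasoning
  N = 2 ℕ.^ suc s
  n = 2 ℕ.^ s
  open CycRing N
  open Embeddings s refl ζ ζ^N≡-1

-- The identity holds already for r ≥ 2.
corollary1 : (r : ℕ) → 4 ≤ r → normα r ≡ const (+ 8)
corollary1 (suc (suc s)) (s≤s (s≤s _)) = normα-2+ s
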